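{- In the setting of the context (with fixed base vertex $x$ and condition $(\ast)$ assumed for $x$), let $Z$ be the common value of the two sides of $(\ast)$. Then: (i) $Z\in T$; (ii) for $0\le i\le D$, $ZE_i=E_iZ=E_i\mathsf BE_i\bigl(1+\frac{\vartheta_i}{q+q^{ -1}}\bigr)$; (iii) for $0\le i\le D$, $ZE^*_i=E^*_iZ=E^*_i\mathsf AE^*_i\bigl(1+\frac{\vartheta_i}{q+q^{ -1}}\bigr)$; (iv) $Z$ is central in $T$.
   Context: Let $\Gamma$ be a finite, undirected, connected graph without loops or multiple edges, with vertex set $X$, path-length distance $\partial$, and diameter $D\ge3$, assumed distance-regular (for $\partial(y,z)=h$ the number $|\{w:\partial(y,w)=i,\partial(z,w)=j\}|$ depends only on $h,i,j$). Matrices lie in $\mathrm{Mat}_X(\mathbb C)$; $I$ is the identity, $J$ the all-ones matrix. $A_i$ is the $i$th distance matrix, $A=A_1$ the adjacency matrix, $M=\mathrm{span}\{A_0,\dots,A_D\}$ the Bose–Mesner algebra. Let $E_0,\dots,E_D$ be an ordering of the primitive idempotents of $M$ ($E_iE_j=\delta_{ij}E_i$, $\sum E_i=I$, $E_0=|X|^{ -1}J$), $A=\sum_i\theta_iE_i$. Define $P,Q$ by $A_j=\sum_iP_{i,j}E_i$, $E_j=|X|^{ -1}\sum_iQ_{i,j}A_i$. Assume $P=Q$ (formal self-duality) and that there are $q,a,\alpha,\varepsilon\in\mathbb C$ with $q\ne0$, $q^2\ne\pm1$, $a\alpha\ne0$, and $\theta_i=\alpha(aq^{2i-D}+a^{ -1}q^{D-2i})+\varepsilon$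 for $0\le i\le D$. Write $\vartheta_i=aq^{2i-D}+a^{ -1}q^{D-2i}$. Fix $x\in X$. $E^*_i$ is the diagonal matrix with $(y,y)$-entry $1$ if $\partial(x,y)=i$ and $0$ otherwise; $A^*$ is the diagonal matrix with $(y,y)$-entry $|X|(E_1)_{x,y}$; $M^*=\mathrm{span}\{E^*_0,\dots,E^*_D\}$; $T$ is the subalgebra of $\mathrm{Mat}_X(\mathbb C)$ generated by $M$ and $M^*$. Put $\mathsf A=(A-\varepsilon I)/\alpha$, $\mathsf B=(A^*-\varepsilon I)/\alpha$. Condition $(\ast)$: $\sum_{i=0}^DE^*_i\mathsf AE^*_i\bigl(1+\frac{\vartheta_i}{q+q^{ -1}}\bigr)=\sum_{i=0}^DE_i\mathsf BE_i\bigl(1+\frac{\vartheta_i}{q+q^{ -1}}\bigr)$. -}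

module Defs where

open import Level using (0ℓ)
open import Algebra.Bundles using (CommutativeRing)
open import Data.Nat using (ℕ; zero; suc; _≡ᵇ_)
open import Data.Bool using (Bool; true; false; if_then_else_)
open import Data.Fin using (Fin; zero; suc)
open import Data.Fin.Properties using (_≟_)
open import Data.List using (List; length; filter)
open import Data.List.Base using (allFin)
open import Data.Product using (_×_; Σ; ∃)
open import Relation.Nullary using (¬_; does)
open import Relation.Nullary.Decidable using (_×-dec_)
open import Relation.Binary.PropositionalEquality using (_≡_)
import Data.Nat as ℕ
import Data.Nat.Properties as ℕP

ringFromℕ : (R : CommutativeRing 0ℓ 0ℓ) → ℕ → CommutativeRing.Carrier R
ringFromℕ R zero = CommutativeRing.0# R
ringFromℕ R (suc m) = CommutativeRing._+_ R (CommutativeRing.1# R) (ringFromℕ R m)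

-- A field of characteristic zero (stand-in for ℂ, which agda-stdlib lacks).
record Field : Set₁ where
  field
    cring : CommutativeRing 0ℓ 0ℓ
  open CommutativeRing cring public
  field
    0≉1   : ¬ (0# ≈ 1#)
    inv   : ∀ x → ¬ (x ≈ 0#) → Σ Carrier (λ y → (x * y) ≈ 1#)
    char0 : ∀ m → ¬ (ringFromℕ cring (suc m) ≈ 0#)

module Core (F : Field) (n : ℕ) where
  open Field F using (cring; Carrier; _≈_; _+_; _*_; 0#; 1#)

  fromℕ : ℕ → Carrier
  fromℕ = ringFromℕ cring

  X : Set
  X = Fin n

  Mat : Set
  Mat = X → X → Carrier

  sumFin : ∀ {m} → (Fin m → Carrier) → Carrier
  sumFin {zero} f = 0#
  sumFin {suc m} f = f zero + sumFin (λ i → f (suc i))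

  infixl 7 _·_
  infixl 7 _•_
  infixl 6 _⊕_
  infix 4 _≋_

  _·_ : Mat → Mat → Mat
  (M · N) y z = sumFin (λ w → M y w * N w z)

  _⊕_ : Mat → Mat → Mat
  (M ⊕ N) y z = M y z + N y z

  _•_ : Carrier → Mat → Mat
  (c • M) y z = c * M y z

  _≋_ : Mat → Mat → Set
  M ≋ N = ∀ y z → M y z ≈ N y z

  𝟎 : Mat
  𝟎 y z = 0#

  𝐉 : Mat
  𝐉 y z = 1#

  diag : (X → Carrier) → Mat
  diag f y z = if does (y ≟ z) then f y else 0#

  𝐈 : Mat
  𝐈 = diag (λ _ → 1#)

  sumTo : ℕ → (ℕ → Mat) → Mat
  sumTo zero f = f 0
  sumTo (suc k) f = sumTo k f ⊕ f (suc k)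

  pow : Carrier → ℕ → Carrier
  pow c zero = 1#
  pow c (suc m) = c * pow c m

  data Walk (adj : X → X → Bool) : X → X → ℕ → Set where
    here : ∀ y → Walk adj y y 0
    step : ∀ {y w z k} → adj y w ≡ true → Walk adj w z k → Walk adj y z (suc k)

  -- ∂ is the path-length distance of adj (in particular adj is connected)
  IsPathDistance : (X → X → Bool) → (X → X → ℕ) → Set
  IsPathDistance adj ∂ =
    ∀ y z → Walk adj y z (∂ y z) × (∀ k → Walk adj y z k → ∂ y z ℕ.≤ k)

  IsDiameter : (X → X → ℕ) → ℕ → Set
  IsDiameter ∂ D = (∀ y z → ∂ y z ℕ.≤ D) × ∃ (λ y → ∃ (λ z → ∂ y z ≡ D))

  count : (X → X → ℕ) → X → X → ℕ → ℕ → ℕ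
  count ∂ y z i j =
    length (filter (λ w → (∂ y w ℕP.≟ i) ×-dec (∂ z w ℕP.≟ j)) (allFin n))

  DistanceRegular : (X → X → ℕ) → Set
  DistanceRegular ∂ = ∀ y z y′ z′ i j → ∂ y z ≡ ∂ y′ z′ →
    count ∂ y z i j ≡ count ∂ y′ z′ i j

  distMat : (X → X → ℕ) → ℕ → Mat
  distMat ∂ i y z = if ∂ y z ≡ᵇ i then 1# else 0#

  dualIdem : (X → X → ℕ) → X → ℕ → Mat
  dualIdem ∂ x i = diag (λ y → if ∂ x y ≡ᵇ i then 1# else 0#)

  data InT (∂ : X → X → ℕ) (x : X) : Mat → Set where
    genA    : ∀ i → InT ∂ x (distMat ∂ i)
    genE*   : ∀ i → InT ∂ x (dualIdem ∂ x i)
    closeAdd : ∀ {M N} → InT ∂ x M → InT ∂ x N → InT ∂ x (M ⊕ N)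
    closeMul : ∀ {M N} → InT ∂ x M → InT ∂ x N → InT ∂ x (M · N)
    closeScal : ∀ c {M} → InT ∂ x M → InT ∂ x (c • M)
    closeEq  : ∀ {M N} → M ≋ N → InT ∂ x M → InT ∂ x N

{-# OPTIONS --safe #-}
-- Both sides of (∗) are block sums Σᵢ cᵢ Gᵢ Kᵢ Gᵢ over a system of
-- orthogonal idempotents (the Eᵢ, respectively the E*ᵢ), and multiplying such a
-- sum by Gᵢ on either side isolates its i-th block; this gives (ii) and (iii).
-- In particular Z commutes with every Eᵢ and every E*ᵢ, hence with every Aᵢ
-- (a combination of the Eᵢ), hence with all of T, which is (iv). Finally Z ∈ T
-- because it is built from the E*ᵢ, A and I = A₀ by sums and products.
module Submission where

open import Defs
open import Data.Nat using (ℕ; _≤_; _*_)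
open import Data.Bool using (Bool; true; false)
open import Data.Product using (_×_)
open import Relation.Nullary using (¬_)
open import Relation.Binary.PropositionalEquality using (_≡_; _≢_)

open import Level using (0ℓ)
open import Data.Bool using (T; if_then_else_)
open import Data.Empty using (⊥-elim)
open import Data.Unit using (tt)
open import Data.Fin using (Fin; zero; suc; punchIn)
open import Data.Fin.Properties using (_≟_; punchInᵢ≢i)
open import Data.Nat using (zero; suc; _≡ᵇ_; _<_; z≤n; s≤s)
import Data.Nat.Properties as ℕₚ
open import Data.Product using (_,_; proj₁; proj₂)
open import Data.Vec.Functional using (replicate)
open import Function using (_∘_)
open import Relation.Binary.Bundles using (Setoid)
open import Relation.Nullary using (yes; no)
import Relation.Binary.PropositionalEquality as ≡
import Relation.Binary.Reasoning.Setoid as SetoidReasoning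

≡ᵇ-true⇒≡ : ∀ m k → (m ≡ᵇ k) ≡ true → m ≡ k
≡ᵇ-true⇒≡ m k eq = ℕₚ.≡ᵇ⇒≡ m k (≡.subst T (≡.sym eq) tt)

module Matrices (F : Field) (n : ℕ) where
  open Field F hiding (zero) renaming (_*_ to _⋆_)
  open Core F n
  open import Algebra.Properties.Semiring.Sum semiring
    using (sum; sum-cong-≋; sum-remove; sum-replicate-zero; ∑-comm; ∑-distrib-+;
           *-distribˡ-sum; *-distribʳ-sum)
  open import Algebra.Properties.CommutativeSemigroup *-commutativeSemigroup using (x∙yz≈y∙xz)
  module ≈-Reasoning = SetoidReasoning setoid

  sumFin≡sum : ∀ {m} (f : Fin m → Carrier) → sumFin f ≡ sum f
  sumFin≡sum {zero} f = ≡.refl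
  sumFin≡sum {suc m} f = ≡.cong (f zero +_) (sumFin≡sum (f ∘ suc))

  sum-point : ∀ {m} (f : Fin m → Carrier) (y : Fin m) →
    (∀ w → w ≢ y → f w ≈ 0#) → sum f ≈ f y
  sum-point {zero} f () _
  sum-point {suc m} f y off = begin
    sum f                                ≈⟨ sum-remove {i = y} f ⟩
    f y + sum (f ∘ punchIn y)            ≈⟨ +-congˡ (sum-cong-≋ (λ w → off _ (punchInᵢ≢i y w))) ⟩
    f y + sum (replicate m 0#)           ≈⟨ +-congˡ (sum-replicate-zero m) ⟩
    f y + 0#                             ≈⟨ +-identityʳ (f y) ⟩
    f y                                  ∎
    where open ≈-Reasoning

  ·-entry : ∀ M N y z → (M · N) y z ≡ sum (λ w → M y w ⋆ N w z)
  ·-entry M N y z = sumFin≡sum (λ w → M y w ⋆ N w z)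

  ≋-setoid : Setoid 0ℓ 0ℓ
  ≋-setoid = record
    { Carrier = Mat
    ; _≈_ = _≋_
    ; isEquivalence = record
      { refl = λ _ _ → refl
      ; sym = λ p y z → sym (p y z)
      ; trans = λ p q y z → trans (p y z) (q y z)
      }
    }

  open Setoid ≋-setoid public using () renaming (refl to ≋-refl; sym to ≋-sym; trans to ≋-trans)
  module ≋-Reasoning = SetoidReasoning ≋-setoid

  ·-cong : ∀ {M M′ N N′} → M ≋ M′ → N ≋ N′ → M · N ≋ M′ · N′
  ·-cong {M} {M′} {N} {N′} p q y z = begin
    (M · N) y z                   ≡⟨ ·-entry M N y z ⟩
    sum (λ w → M y w ⋆ N w z)     ≈⟨ sum-cong-≋ (λ w → *-cong (p y w) (q w z)) ⟩
    sum (λ w → M′ y w ⋆ N′ w z)   ≡⟨ ≡.sym (·-entry M′ N′ y z) ⟩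
    (M′ · N′) y z                 ∎
    where open ≈-Reasoning

  ·-congˡ : ∀ {M N N′} → N ≋ N′ → M · N ≋ M · N′
  ·-congˡ = ·-cong ≋-refl

  ·-congʳ : ∀ {M M′ N} → M ≋ M′ → M · N ≋ M′ · N
  ·-congʳ p = ·-cong p ≋-refl

  ⊕-cong : ∀ {M M′ N N′} → M ≋ M′ → N ≋ N′ → M ⊕ N ≋ M′ ⊕ N′
  ⊕-cong p q y z = +-cong (p y z) (q y z)

  •-congˡ : ∀ {c M N} → M ≋ N → c • M ≋ c • N
  •-congˡ p y z = *-congˡ (p y z)

  ·-assoc : ∀ M N P → (M · N) · P ≋ M · (N · P)
  ·-assoc M N P y z = begin
    ((M · N) · P) y z
      ≡⟨ ·-entry (M · N) P y z ⟩
    sum (λ w → (M · N) y w ⋆ P w z)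
      ≈⟨ sum-cong-≋ (λ w → *-congʳ (reflexive (·-entry M N y w))) ⟩
    sum (λ w → sum (λ v → M y v ⋆ N v w) ⋆ P w z)
      ≈⟨ sum-cong-≋ (λ w → *-distribʳ-sum (P w z) (λ v → M y v ⋆ N v w)) ⟩
    sum (λ w → sum (λ v → M y v ⋆ N v w ⋆ P w z))
      ≈⟨ ∑-comm (λ w v → M y v ⋆ N v w ⋆ P w z) ⟩
    sum (λ v → sum (λ w → M y v ⋆ N v w ⋆ P w z))
      ≈⟨ sum-cong-≋ (λ v → sum-cong-≋ (λ w → *-assoc (M y v) (N v w) (P w z))) ⟩
    sum (λ v → sum (λ w → M y v ⋆ (N v w ⋆ P w z)))
      ≈⟨ sum-cong-≋ (λ v → sym (*-distribˡ-sum (M y v) (λ w → N v w ⋆ P w z))) ⟩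
    sum (λ v → M y v ⋆ sum (λ w → N v w ⋆ P w z))
      ≈⟨ sum-cong-≋ (λ v → *-congˡ (reflexive (≡.sym (·-entry N P v z)))) ⟩
    sum (λ v → M y v ⋆ (N · P) v z)
      ≡⟨ ≡.sym (·-entry M (N · P) y z) ⟩
    (M · (N · P)) y z ∎
    where open ≈-Reasoning

  ·-distribˡ-⊕ : ∀ M N P → M · (N ⊕ P) ≋ M · N ⊕ M · P
  ·-distribˡ-⊕ M N P y z = begin
    (M · (N ⊕ P)) y z
      ≡⟨ ·-entry M (N ⊕ P) y z ⟩
    sum (λ w → M y w ⋆ (N w z + P w z))
      ≈⟨ sum-cong-≋ (λ w → distribˡ (M y w) (N w z) (P w z)) ⟩
    sum (λ w → M y w ⋆ N w z + M y w ⋆ P w z)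
      ≈⟨ ∑-distrib-+ (λ w → M y w ⋆ N w z) (λ w → M y w ⋆ P w z) ⟩
    sum (λ w → M y w ⋆ N w z) + sum (λ w → M y w ⋆ P w z)
      ≡⟨ ≡.cong₂ _+_ (·-entry M N y z) (·-entry M P y z) ⟨
    (M · N ⊕ M · P) y z ∎
    where open ≈-Reasoning

  ·-distribʳ-⊕ : ∀ M N P → (M ⊕ N) · P ≋ M · P ⊕ N · P
  ·-distribʳ-⊕ M N P y z = begin
    ((M ⊕ N) · P) y z
      ≡⟨ ·-entry (M ⊕ N) P y z ⟩
    sum (λ w → (M y w + N y w) ⋆ P w z)
      ≈⟨ sum-cong-≋ (λ w → distribʳ (P w z) (M y w) (N y w)) ⟩
    sum (λ w → M y w ⋆ P w z + N y w ⋆ P w z)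
      ≈⟨ ∑-distrib-+ (λ w → M y w ⋆ P w z) (λ w → N y w ⋆ P w z) ⟩
    sum (λ w → M y w ⋆ P w z) + sum (λ w → N y w ⋆ P w z)
      ≡⟨ ≡.cong₂ _+_ (·-entry M P y z) (·-entry N P y z) ⟨
    (M · P ⊕ N · P) y z ∎
    where open ≈-Reasoning

  •-·-assoc : ∀ c M N → (c • M) · N ≋ c • (M · N)
  •-·-assoc c M N y z = begin
    ((c • M) · N) y z                  ≡⟨ ·-entry (c • M) N y z ⟩
    sum (λ w → c ⋆ M y w ⋆ N w z)      ≈⟨ sum-cong-≋ (λ w → *-assoc c (M y w) (N w z)) ⟩
    sum (λ w → c ⋆ (M y w ⋆ N w z))    ≈⟨ *-distribˡ-sum c (λ w → M y w ⋆ N w z) ⟨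
    c ⋆ sum (λ w → M y w ⋆ N w z)      ≡⟨ ≡.cong (c ⋆_) (·-entry M N y z) ⟨
    (c • (M · N)) y z                  ∎
    where open ≈-Reasoning

  ·-•-comm : ∀ c M N → M · (c • N) ≋ c • (M · N)
  ·-•-comm c M N y z = begin
    (M · (c • N)) y z                  ≡⟨ ·-entry M (c • N) y z ⟩
    sum (λ w → M y w ⋆ (c ⋆ N w z))    ≈⟨ sum-cong-≋ (λ w → x∙yz≈y∙xz (M y w) c (N w z)) ⟩
    sum (λ w → c ⋆ (M y w ⋆ N w z))    ≈⟨ *-distribˡ-sum c (λ w → M y w ⋆ N w z) ⟨
    c ⋆ sum (λ w → M y w ⋆ N w z)      ≡⟨ ≡.cong (c ⋆_) (·-entry M N y z) ⟨
    (c • (M · N)) y z                  ∎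
    where open ≈-Reasoning

  ·-zeroˡ : ∀ M → 𝟎 · M ≋ 𝟎
  ·-zeroˡ M y z = trans (reflexive (·-entry 𝟎 M y z))
    (trans (sum-cong-≋ (λ w → zeroˡ (M w z))) (sum-replicate-zero n))

  ·-zeroʳ : ∀ M → M · 𝟎 ≋ 𝟎
  ·-zeroʳ M y z = trans (reflexive (·-entry M 𝟎 y z))
    (trans (sum-cong-≋ (λ w → zeroʳ (M y w))) (sum-replicate-zero n))

  •-zeroʳ : ∀ c → c • 𝟎 ≋ 𝟎
  •-zeroʳ c y z = zeroʳ c

  ⊕-identityˡ : ∀ M → 𝟎 ⊕ M ≋ M
  ⊕-identityˡ M y z = +-identityˡ (M y z)

  ⊕-identityʳ : ∀ M → M ⊕ 𝟎 ≋ M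
  ⊕-identityʳ M y z = +-identityʳ (M y z)

  sumTo-·ʳ : ∀ k (f : ℕ → Mat) M → sumTo k f · M ≋ sumTo k (λ i → f i · M)
  sumTo-·ʳ zero f M = ≋-refl
  sumTo-·ʳ (suc k) f M =
    ≋-trans (·-distribʳ-⊕ (sumTo k f) (f (suc k)) M) (⊕-cong (sumTo-·ʳ k f M) ≋-refl)

  sumTo-·ˡ : ∀ k (f : ℕ → Mat) M → M · sumTo k f ≋ sumTo k (λ i → M · f i)
  sumTo-·ˡ zero f M = ≋-refl
  sumTo-·ˡ (suc k) f M =
    ≋-trans (·-distribˡ-⊕ M (sumTo k f) (f (suc k))) (⊕-cong (sumTo-·ˡ k f M) ≋-refl)

  sumTo-zero : ∀ k (f : ℕ → Mat) → (∀ j → j ≤ k → f j ≋ 𝟎) → sumTo k f ≋ 𝟎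
  sumTo-zero zero f f≋𝟎 = f≋𝟎 0 z≤n
  sumTo-zero (suc k) f f≋𝟎 = ≋-trans
    (⊕-cong (sumTo-zero k f (λ j j≤k → f≋𝟎 j (ℕₚ.m≤n⇒m≤1+n j≤k))) (f≋𝟎 (suc k) ℕₚ.≤-refl))
    (⊕-identityˡ 𝟎)

  sumTo-single : ∀ k i (f : ℕ → Mat) → i ≤ k → (∀ j → j ≤ k → j ≢ i → f j ≋ 𝟎) → sumTo k f ≋ f i
  sumTo-single zero zero f z≤n _ = ≋-refl
  sumTo-single (suc k) i f i≤1+k off with i ℕₚ.≟ suc k
  ... | yes ≡.refl = ≋-trans
        (⊕-cong (sumTo-zero k f (λ j j≤k → off j (ℕₚ.m≤n⇒m≤1+n j≤k) (ℕₚ.<⇒≢ (s≤s j≤k)))) ≋-refl)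
        (⊕-identityˡ (f i))
  ... | no i≢1+k = ≋-trans
        (⊕-cong (sumTo-single k i f (ℕₚ.≤-pred (ℕₚ.≤∧≢⇒< i≤1+k i≢1+k))
                   (λ j j≤k → off j (ℕₚ.m≤n⇒m≤1+n j≤k)))
                (off (suc k) ℕₚ.≤-refl (i≢1+k ∘ ≡.sym)))
        (⊕-identityʳ (f i))

  diag-cong : ∀ {f g : X → Carrier} → (∀ y → f y ≈ g y) → diag f ≋ diag g
  diag-cong f≈g y z with y ≟ z
  ... | yes _ = f≈g y
  ... | no _ = refl

  diag-zero : diag (λ _ → 0#) ≋ 𝟎
  diag-zero y z with y ≟ z
  ... | yes _ = refl
  ... | no _ = refl

  diag-·-diag : ∀ f g → diag f · diag g ≋ diag (λ y → f y ⋆ g y)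
  diag-·-diag f g y z = begin
    (diag f · diag g) y z                ≡⟨ ·-entry (diag f) (diag g) y z ⟩
    sum (λ w → diag f y w ⋆ diag g w z)  ≈⟨ sum-point _ y off-diagonal ⟩
    diag f y y ⋆ diag g y z              ≈⟨ on-diagonal ⟩
    diag (λ y → f y ⋆ g y) y z           ∎
    where
    open ≈-Reasoning
    off-diagonal : ∀ w → w ≢ y → diag f y w ⋆ diag g w z ≈ 0#
    off-diagonal w w≢y with y ≟ w
    ... | yes y≡w = ⊥-elim (w≢y (≡.sym y≡w))
    ... | no _ = zeroˡ _
    on-diagonal : diag f y y ⋆ diag g y z ≈ diag (λ y → f y ⋆ g y) y z
    on-diagonal with y ≟ y
    ... | no y≢y = ⊥-elim (y≢y ≡.refl)
    ... | yes _ with y ≟ z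
    ...   | yes _ = refl
    ...   | no _ = zeroʳ _

  indicator : Bool → Carrier
  indicator b = if b then 1# else 0#

  indicator-idempotent : ∀ b → indicator b ⋆ indicator b ≈ indicator b
  indicator-idempotent true = *-identityˡ 1#
  indicator-idempotent false = zeroˡ 0#

  indicator-≡ᵇ-≢ : ∀ {m k} → m ≢ k → indicator (m ≡ᵇ k) ≈ 0#
  indicator-≡ᵇ-≢ {m} {k} m≢k with m ≡ᵇ k in m≡ᵇk
  ... | true = ⊥-elim (m≢k (≡ᵇ-true⇒≡ m k m≡ᵇk))
  ... | false = refl

  indicator-≡ᵇ-orthogonal : ∀ {i j} → i ≢ j → ∀ m → indicator (m ≡ᵇ i) ⋆ indicator (m ≡ᵇ j) ≈ 0#
  indicator-≡ᵇ-orthogonal {i} {j} i≢j m with m ≡ᵇ i in m≡ᵇi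
  ... | true = trans (*-identityˡ _) (indicator-≡ᵇ-≢ (i≢j ∘ ≡.trans (≡.sym (≡ᵇ-true⇒≡ m i m≡ᵇi))))
  ... | false = zeroˡ _

  Commute : Mat → Mat → Set
  Commute Z M = Z · M ≋ M · Z

  record OrthogonalIdempotents (D : ℕ) (G : ℕ → Mat) : Set where
    field
      idempotent : ∀ i → i ≤ D → G i · G i ≋ G i
      orthogonal : ∀ i j → i ≤ D → j ≤ D → i ≢ j → G i · G j ≋ 𝟎

  block-·-idempotent : ∀ G K → G · G ≋ G → G · K · G · G ≋ G · K · G
  block-·-idempotent G K GG≋G = ≋-trans (·-assoc (G · K) G G) (·-congˡ GG≋G)

  idempotent-·-block : ∀ G K → G · G ≋ G → G · (G · K · G) ≋ G · K · G
  idempotent-·-block G K GG≋G = begin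
    G · (G · K · G)    ≈⟨ ·-assoc G (G · K) G ⟨
    G · (G · K) · G    ≈⟨ ·-congʳ (·-assoc G G K) ⟨
    G · G · K · G      ≈⟨ ·-congʳ (·-congʳ GG≋G) ⟩
    G · K · G          ∎
    where open ≋-Reasoning

  block-·-orthogonal : ∀ G H K → G · H ≋ 𝟎 → G · K · G · H ≋ 𝟎
  block-·-orthogonal G H K GH≋𝟎 =
    ≋-trans (·-assoc (G · K) G H) (≋-trans (·-congˡ GH≋𝟎) (·-zeroʳ (G · K)))

  orthogonal-·-block : ∀ G H K → H · G ≋ 𝟎 → H · (G · K · G) ≋ 𝟎
  orthogonal-·-block G H K HG≋𝟎 = begin
    H · (G · K · G)    ≈⟨ ·-assoc H (G · K) G ⟨
    H · (G · K) · G    ≈⟨ ·-congʳ (·-assoc H G K) ⟨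
    H · G · K · G      ≈⟨ ·-congʳ (·-congʳ HG≋𝟎) ⟩
    𝟎 · K · G          ≈⟨ ·-congʳ (·-zeroˡ K) ⟩
    𝟎 · G              ≈⟨ ·-zeroˡ G ⟩
    𝟎                  ∎
    where open ≋-Reasoning

  module _ {D : ℕ} {G : ℕ → Mat} (idem : OrthogonalIdempotents D G) (c : ℕ → Carrier) (K : ℕ → Mat) where
    open OrthogonalIdempotents idem

    blockSum-·-idempotent : ∀ i → i ≤ D →
      sumTo D (λ j → c j • (G j · K j · G j)) · G i ≋ c i • (G i · K i · G i)
    blockSum-·-idempotent i i≤D = begin
      sumTo D (λ j → c j • (G j · K j · G j)) · G i
        ≈⟨ sumTo-·ʳ D _ (G i) ⟩
      sumTo D (λ j → c j • (G j · K j · G j) · G i)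
        ≈⟨ sumTo-single D i _ i≤D off-diagonal ⟩
      c i • (G i · K i · G i) · G i
        ≈⟨ •-·-assoc (c i) _ (G i) ⟩
      c i • (G i · K i · G i · G i)
        ≈⟨ •-congˡ (block-·-idempotent (G i) (K i) (idempotent i i≤D)) ⟩
      c i • (G i · K i · G i) ∎
      where
      open ≋-Reasoning
      off-diagonal : ∀ j → j ≤ D → j ≢ i → c j • (G j · K j · G j) · G i ≋ 𝟎
      off-diagonal j j≤D j≢i = ≋-trans (•-·-assoc (c j) _ (G i)) (≋-trans
        (•-congˡ (block-·-orthogonal (G j) (G i) (K j) (orthogonal j i j≤D i≤D j≢i)))
        (•-zeroʳ (c j)))

    idempotent-·-blockSum : ∀ i → i ≤ D →
      G i · sumTo D (λ j → c j • (G j · K j · G j)) ≋ c i • (G i · K i · G i)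
    idempotent-·-blockSum i i≤D = begin
      G i · sumTo D (λ j → c j • (G j · K j · G j))
        ≈⟨ sumTo-·ˡ D _ (G i) ⟩
      sumTo D (λ j → G i · (c j • (G j · K j · G j)))
        ≈⟨ sumTo-single D i _ i≤D off-diagonal ⟩
      G i · (c i • (G i · K i · G i))
        ≈⟨ ·-•-comm (c i) (G i) _ ⟩
      c i • (G i · (G i · K i · G i))
        ≈⟨ •-congˡ (idempotent-·-block (G i) (K i) (idempotent i i≤D)) ⟩
      c i • (G i · K i · G i) ∎
      where
      open ≋-Reasoning
      off-diagonal : ∀ j → j ≤ D → j ≢ i → G i · (c j • (G j · K j · G j)) ≋ 𝟎
      off-diagonal j j≤D j≢i = ≋-trans (·-•-comm (c j) (G i) _) (≋-trans
        (•-congˡ (orthogonal-·-block (G j) (G i) (K j) (orthogonal i j i≤D j≤D (j≢i ∘ ≡.sym))))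
        (•-zeroʳ (c j)))

    idempotent-isolates-block : ∀ {Z} → Z ≋ sumTo D (λ j → c j • (G j · K j · G j)) → ∀ i → i ≤ D →
      Commute Z (G i) × Z · G i ≋ c i • (G i · K i · G i)
    idempotent-isolates-block {Z} Z≋ i i≤D = ≋-trans ZG (≋-sym GZ) , ZG
      where
      ZG : Z · G i ≋ c i • (G i · K i · G i)
      ZG = ≋-trans (·-congʳ Z≋) (blockSum-·-idempotent i i≤D)
      GZ : G i · Z ≋ c i • (G i · K i · G i)
      GZ = ≋-trans (·-congˡ Z≋) (idempotent-·-blockSum i i≤D)

  commute-⊕ : ∀ {Z M N} → Commute Z M → Commute Z N → Commute Z (M ⊕ N)
  commute-⊕ {Z} {M} {N} ZM ZN = begin
    Z · (M ⊕ N)       ≈⟨ ·-distribˡ-⊕ Z M N ⟩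
    Z · M ⊕ Z · N     ≈⟨ ⊕-cong ZM ZN ⟩
    M · Z ⊕ N · Z     ≈⟨ ·-distribʳ-⊕ M N Z ⟨
    (M ⊕ N) · Z       ∎
    where open ≋-Reasoning

  commute-· : ∀ {Z M N} → Commute Z M → Commute Z N → Commute Z (M · N)
  commute-· {Z} {M} {N} ZM ZN = begin
    Z · (M · N)       ≈⟨ ·-assoc Z M N ⟨
    Z · M · N         ≈⟨ ·-congʳ ZM ⟩
    M · Z · N         ≈⟨ ·-assoc M Z N ⟩
    M · (Z · N)       ≈⟨ ·-congˡ ZN ⟩
    M · (N · Z)       ≈⟨ ·-assoc M N Z ⟨
    M · N · Z         ∎
    where open ≋-Reasoning

  commute-• : ∀ {Z M} c → Commute Z M → Commute Z (c • M)
  commute-• {Z} {M} c ZM =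
    ≋-trans (·-•-comm c Z M) (≋-trans (•-congˡ ZM) (≋-sym (•-·-assoc c M Z)))

  commute-resp : ∀ {Z M N} → M ≋ N → Commute Z M → Commute Z N
  commute-resp M≋N ZM = ≋-trans (·-congˡ (≋-sym M≋N)) (≋-trans ZM (·-congʳ M≋N))

  commute-𝟎 : ∀ {Z M} → M ≋ 𝟎 → Commute Z M
  commute-𝟎 {Z} M≋𝟎 = commute-resp (≋-sym M≋𝟎) (≋-trans (·-zeroʳ Z) (≋-sym (·-zeroˡ Z)))

  commute-sumTo : ∀ {Z} k (f : ℕ → Mat) → (∀ j → j ≤ k → Commute Z (f j)) → Commute Z (sumTo k f)
  commute-sumTo zero f Zf = Zf 0 z≤n
  commute-sumTo (suc k) f Zf =
    commute-⊕ (commute-sumTo k f (λ j j≤k → Zf j (ℕₚ.m≤n⇒m≤1+n j≤k))) (Zf (suc k) ℕₚ.≤-refl)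

  module _ (∂ : X → X → ℕ) (x : X) where

    InT-commute : ∀ {Z} → (∀ i → Commute Z (distMat ∂ i)) → (∀ i → Commute Z (dualIdem ∂ x i)) →
      ∀ {Y} → InT ∂ x Y → Commute Z Y
    InT-commute ZA ZE* (genA i) = ZA i
    InT-commute ZA ZE* (genE* i) = ZE* i
    InT-commute ZA ZE* (closeAdd M N) = commute-⊕ (InT-commute ZA ZE* M) (InT-commute ZA ZE* N)
    InT-commute ZA ZE* (closeMul M N) = commute-· (InT-commute ZA ZE* M) (InT-commute ZA ZE* N)
    InT-commute ZA ZE* (closeScal c M) = commute-• c (InT-commute ZA ZE* M)
    InT-commute ZA ZE* (closeEq M≋N M) = commute-resp M≋N (InT-commute ZA ZE* M)

    InT-sumTo : ∀ k (f : ℕ → Mat) → (∀ i → InT ∂ x (f i)) → InT ∂ x (sumTo k f)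
    InT-sumTo zero f f∈T = f∈T 0
    InT-sumTo (suc k) f f∈T = closeAdd (InT-sumTo k f f∈T) (f∈T (suc k))

    dualIdem-orthogonalIdempotents : ∀ D → OrthogonalIdempotents D (dualIdem ∂ x)
    dualIdem-orthogonalIdempotents D = record
      { idempotent = λ i _ → ≋-trans (diag-·-diag _ _) (diag-cong (λ y → indicator-idempotent (∂ x y ≡ᵇ i)))
      ; orthogonal = λ i j _ _ i≢j → ≋-trans (diag-·-diag _ _)
                       (≋-trans (diag-cong (λ y → indicator-≡ᵇ-orthogonal i≢j (∂ x y))) diag-zero)
      }

    module _ {D : ℕ} (∂≤D : ∀ y z → ∂ y z ≤ D) {i : ℕ} (D<i : D < i) where

      ∂-≢-beyond : ∀ y z → ∂ y z ≢ i
      ∂-≢-beyond y z ∂≡i = ℕₚ.≤⇒≯ (≡.subst (_≤ D) ∂≡i (∂≤D y z)) D<i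

      dualIdem-beyond-diameter : dualIdem ∂ x i ≋ 𝟎
      dualIdem-beyond-diameter =
        ≋-trans (diag-cong (λ y → indicator-≡ᵇ-≢ (∂-≢-beyond x y))) diag-zero

      distMat-beyond-diameter : distMat ∂ i ≋ 𝟎
      distMat-beyond-diameter y z = indicator-≡ᵇ-≢ (∂-≢-beyond y z)

    module _ {D : ℕ} {Z : Mat} (∂≤D : ∀ y z → ∂ y z ≤ D) where

      commute-distMat : ∀ {E : ℕ → Mat} {P : ℕ → ℕ → Carrier} →
        (∀ j → j ≤ D → distMat ∂ j ≋ sumTo D (λ i → P i j • E i)) →
        (∀ i → i ≤ D → Commute Z (E i)) → ∀ j → Commute Z (distMat ∂ j)
      commute-distMat {E} {P} A≋ΣPE ZE j with j ℕₚ.≤? D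
      ... | yes j≤D = commute-resp (≋-sym (A≋ΣPE j j≤D))
                        (commute-sumTo D (λ i → P i j • E i) (λ i i≤D → commute-• (P i j) (ZE i i≤D)))
      ... | no j≰D = commute-𝟎 (distMat-beyond-diameter ∂≤D (ℕₚ.≰⇒> j≰D))

      commute-dualIdem : (∀ i → i ≤ D → Commute Z (dualIdem ∂ x i)) → ∀ i → Commute Z (dualIdem ∂ x i)
      commute-dualIdem ZE* i with i ℕₚ.≤? D
      ... | yes i≤D = ZE* i i≤D
      ... | no i≰D = commute-𝟎 (dualIdem-beyond-diameter ∂≤D (ℕₚ.≰⇒> i≰D))

      blockSums-commute-with-T :
        ∀ {E : ℕ → Mat} {P : ℕ → ℕ → Carrier} {c c* : ℕ → Carrier} {K K* : ℕ → Mat} →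
        OrthogonalIdempotents D E →
        (∀ j → j ≤ D → distMat ∂ j ≋ sumTo D (λ i → P i j • E i)) →
        Z ≋ sumTo D (λ i → c i • (E i · K i · E i)) →
        Z ≋ sumTo D (λ i → c* i • (dualIdem ∂ x i · K* i · dualIdem ∂ x i)) →
        ∀ {Y} → InT ∂ x Y → Commute Z Y
      blockSums-commute-with-T E-system A≋ΣPE Z≋ΣEKE Z≋ΣE*KE* = InT-commute
        (commute-distMat A≋ΣPE (λ i i≤D → proj₁ (idempotent-isolates-block E-system _ _ Z≋ΣEKE i i≤D)))
        (commute-dualIdem (λ i i≤D →
          proj₁ (idempotent-isolates-block (dualIdem-orthogonalIdempotents D) _ _ Z≋ΣE*KE* i i≤D)))

    InT-dualBlockSum : ∀ k (c : ℕ → Carrier) (K : ℕ → Mat) → (∀ i → InT ∂ x (K i)) →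
      InT ∂ x (sumTo k (λ i → c i • (dualIdem ∂ x i · K i · dualIdem ∂ x i)))
    InT-dualBlockSum k c K K∈T =
      InT-sumTo k _ (λ i → closeScal (c i) (closeMul (closeMul (genE* i) (K∈T i)) (genE* i)))

    module _ {adj : X → X → Bool} (isPath : IsPathDistance adj ∂) where

      distMat-zero≋𝐈 : distMat ∂ 0 ≋ 𝐈
      distMat-zero≋𝐈 y z with y ≟ z
      ... | yes ≡.refl rewrite ℕₚ.n≤0⇒n≡0 (proj₂ (isPath y y) 0 (here y)) = refl
      ... | no y≢z with ∂ y z ≡ᵇ 0 in ∂≡0
      ...   | false = refl
      ...   | true = ⊥-elim (y≢z (walk-endpoints (≡.subst (Walk adj y z) (≡ᵇ-true⇒≡ (∂ y z) 0 ∂≡0)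
                                                            (proj₁ (isPath y z)))))
        where
        walk-endpoints : ∀ {y z} → Walk adj y z 0 → y ≡ z
        walk-endpoints (here _) = ≡.refl

      InT-𝐈 : InT ∂ x 𝐈
      InT-𝐈 = closeEq distMat-zero≋𝐈 (genA 0)

proposition7p7 :
  (F : Field) (n : ℕ) →
  let open Field F renaming (_*_ to _⋆_) in
  let open Core F n in
  (adj : X → X → Bool) → (∀ y → adj y y ≡ false) → (∀ y z → adj y z ≡ adj z y) →
  (∂ : X → X → ℕ) → IsPathDistance adj ∂ →
  (D : ℕ) → 3 ≤ D → IsDiameter ∂ D → DistanceRegular ∂ →
  (E : ℕ → Mat) →
  (∀ i → i ≤ D → E i · E i ≋ E i) →
  (∀ i j → i ≤ D → j ≤ D → i ≢ j → E i · E j ≋ 𝟎) →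
  (∀ i → i ≤ D → ¬ (E i ≋ 𝟎)) →
  sumTo D E ≋ 𝐈 →
  (nInv : Carrier) → (nInv ⋆ fromℕ n) ≈ 1# →
  E 0 ≋ nInv • 𝐉 →
  (P : ℕ → ℕ → Carrier) →
  (∀ j → j ≤ D → distMat ∂ j ≋ sumTo D (λ i → P i j • E i)) →
  (∀ j → j ≤ D → E j ≋ nInv • sumTo D (λ i → P i j • distMat ∂ i)) →
  (q a α ε q⁻¹ a⁻¹ α⁻¹ s⁻¹ : Carrier) →
  (q ⋆ q⁻¹) ≈ 1# → ¬ ((q ⋆ q) ≈ 1#) → ¬ ((q ⋆ q) ≈ (- 1#)) →
  ¬ ((a ⋆ α) ≈ 0#) → (a ⋆ a⁻¹) ≈ 1# → (α ⋆ α⁻¹) ≈ 1# →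
  ((q + q⁻¹) ⋆ s⁻¹) ≈ 1# →
  let ϑ : ℕ → Carrier
      ϑ i = (a ⋆ pow q (2 * i) ⋆ pow q⁻¹ D) + (a⁻¹ ⋆ pow q D ⋆ pow q⁻¹ (2 * i))
      c : ℕ → Carrier
      c i = 1# + (ϑ i ⋆ s⁻¹)
  in
  distMat ∂ 1 ≋ sumTo D (λ i → ((α ⋆ ϑ i) + ε) • E i) →
  (x : X) →
  let Es : ℕ → Mat
      Es = dualIdem ∂ x
      A* : Mat
      A* = diag (λ y → fromℕ n ⋆ E 1 x y)
      𝖠 : Mat
      𝖠 = α⁻¹ • (distMat ∂ 1 ⊕ (- ε) • 𝐈)
      𝖡 : Mat
      𝖡 = α⁻¹ • (A* ⊕ (- ε) • 𝐈)
      Z : Mat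
      Z = sumTo D (λ i → c i • (Es i · 𝖠 · Es i))
  in
  Z ≋ sumTo D (λ i → c i • (E i · 𝖡 · E i)) →
  InT ∂ x Z
  × (∀ i → i ≤ D → (Z · E i ≋ E i · Z) × (Z · E i ≋ c i • (E i · 𝖡 · E i)))
  × (∀ i → i ≤ D → (Z · Es i ≋ Es i · Z) × (Z · Es i ≋ c i • (Es i · 𝖠 · Es i)))
  × (∀ Y → InT ∂ x Y → Z · Y ≋ Y · Z)

proposition7p7 F n _ _ _ ∂ isPath D _ (∂≤D , _) _ E E-idem E-orth _ _ _ _ _ P A≋ΣPE _
  _ _ _ _ _ _ _ _ _ _ _ _ _ _ _ _ x Z≋ΣEBE =
    InT-dualBlockSum ∂ x D _ _ (λ _ → closeScal _ (closeAdd (genA 1) (closeScal _ (InT-𝐈 ∂ x isPath))))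
  , idempotent-isolates-block E-system _ _ Z≋ΣEBE
  , idempotent-isolates-block (dualIdem-orthogonalIdempotents ∂ x D) _ _ ≋-refl
  , λ _ → blockSums-commute-with-T ∂ x ∂≤D E-system A≋ΣPE Z≋ΣEBE ≋-refl
  where
  open Core F n
  open Matrices F n
  E-system : OrthogonalIdempotents D E
  E-system = record { idempotent = E-idem ; orthogonal = E-orth }
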